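{- For any two connected graphs $G_1$ and $G_2$, $$\chi_d^t(G_1\star G_2)\leq \chi_d^t(G_1)+\chi_d^t(G_2).$$
   Context: All graphs are simple and finite. A total dominator coloring (TD-coloring) of a graph $G$ with no isolated vertex is a proper vertex coloring of $G$ in which every vertex of $G$ is adjacent to every vertex of some (other) color class. The total dominator chromatic number $\chi_d^t(G)$ is the minimum number of color classes in a TD-coloring of $G$. The neighbourhood corona $G_1\star G_2$ is the graph obtained by taking one copy of $G_1$ and $|V(G_1)|$ copies of $G_2$, and joining every neighbour (in $G_1$) of the $i$th vertex of $G_1$ to every vertex in the $i$th copy of $G_2$. -}

module Defs where

open import Data.Nat using (ℕ; _+_; _*_; _≤_; _≥_)
open import Data.Fin using (Fin; splitAt; remQuot; _≟_)
open import Data.Bool using (Bool; true; false; _∧_)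
open import Data.Sum using (_⊎_; inj₁; inj₂)
open import Data.Product using (Σ; ∃; _×_; _,_)
open import Relation.Nullary using (¬_)
open import Relation.Nullary.Decidable using (⌊_⌋)
open import Relation.Binary.PropositionalEquality using (_≡_)

record Graph : Set where
  field
    order : ℕ
    adj   : Fin order → Fin order → Bool

open Graph public

Adj : (G : Graph) → Fin (order G) → Fin (order G) → Set
Adj G u v = adj G u v ≡ true

IsSimple : Graph → Set
IsSimple G = (∀ u v → adj G u v ≡ adj G v u) × (∀ v → adj G v v ≡ false)

data Walk (G : Graph) : Fin (order G) → Fin (order G) → Set where
  here : ∀ {v} → Walk G v v
  step : ∀ {u w v} → Adj G u w → Walk G w v → Walk G u v

Connected : Graph → Set
Connected G = ∀ u v → Walk G u v

NoIsolated : Graph → Set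
NoIsolated G = ∀ v → ∃ λ u → Adj G v u

-- A total dominator coloring with exactly k (nonempty) color classes:
-- a surjective proper coloring such that every vertex is adjacent to every
-- vertex of some color class.
record TDColoring (G : Graph) (k : ℕ) : Set where
  field
    color      : Fin (order G) → Fin k
    surjective : ∀ (j : Fin k) → ∃ λ v → color v ≡ j
    proper     : ∀ u v → Adj G u v → ¬ (color u ≡ color v)
    dominating : ∀ v → ∃ λ (j : Fin k) → ∀ u → color u ≡ j → Adj G v u

IsTDChromaticNumber : Graph → ℕ → Set
IsTDChromaticNumber G k = TDColoring G k × (∀ m → TDColoring G m → k ≤ m)

-- Neighbourhood corona G₁ ⋆ G₂.  Vertices: Fin (n₁ + n₁ * n₂);
-- splitAt gives either a vertex i of G₁ (inj₁ i) or a pair (i , x) = vertex x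
-- of the i-th copy of G₂ (inj₂ via remQuot).
coronaAdj : (G₁ G₂ : Graph) →
  (Fin (order G₁) ⊎ (Fin (order G₁) × Fin (order G₂))) →
  (Fin (order G₁) ⊎ (Fin (order G₁) × Fin (order G₂))) → Bool
coronaAdj G₁ G₂ (inj₁ i)       (inj₁ j)       = adj G₁ i j
coronaAdj G₁ G₂ (inj₁ i)       (inj₂ (j , y)) = adj G₁ i j
coronaAdj G₁ G₂ (inj₂ (i , x)) (inj₁ j)       = adj G₁ i j
coronaAdj G₁ G₂ (inj₂ (i , x)) (inj₂ (j , y)) = ⌊ i ≟ j ⌋ ∧ adj G₂ x y

decode : (G₁ G₂ : Graph) → Fin (order G₁ + order G₁ * order G₂) →
  Fin (order G₁) ⊎ (Fin (order G₁) × Fin (order G₂))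
decode G₁ G₂ v with splitAt (order G₁) v
... | inj₁ i = inj₁ i
... | inj₂ p = inj₂ (remQuot (order G₂) p)

_⋆_ : Graph → Graph → Graph
G₁ ⋆ G₂ = record
  { order = order G₁ + order G₁ * order G₂
  ; adj   = λ u v → coronaAdj G₁ G₂ (decode G₁ G₂ u) (decode G₁ G₂ v)
  }

-- A TD-coloring c₁ of G₁ with k₁ classes and c₂ of G₂ with k₂ classes give one of
-- G₁ ⋆ G₂ with k₁ + k₂ classes: color the vertices of G₁ by c₁ and every copy of G₂
-- by c₂, on disjoint palettes.  The i-th copy of G₂ sees exactly the neighbours of i
-- in G₁, so each vertex of G₁ ⋆ G₂ is adjacent to the whole c₁-class that its base
-- vertex i dominates in G₁.  Since TD-colorability with k colors is decidable, the
-- minimum χ_d^t(G₁ ⋆ G₂) exists and is at most k₁ + k₂.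
module Submission where

open import Defs
open import Data.Nat using (ℕ; zero; suc; _+_; _*_; _≤_; _<_; z≤n)
open import Data.Nat.Properties using (≤-refl; ≤-trans; <⇒≤; ≮⇒≥; anyUpTo?)
open import Data.Nat.Induction using (<-rec)
open import Data.Product using (∃; _×_; _,_; proj₁; proj₂)
open import Data.Sum using (_⊎_; inj₁; inj₂)
open import Data.Empty using (⊥-elim)
open import Function using (_∘_)
open import Data.Vec.Functional using (Vector; _∷_; head; tail)
open import Data.Bool using (true)
import Data.Bool.Properties as Bool
open import Data.Fin using (Fin; zero; suc; _↑ˡ_; _↑ʳ_; splitAt; combine)
open import Data.Fin.Properties
  using (suc-injective; ↑ˡ-injective; ↑ʳ-injective; splitAt-↑ˡ; splitAt-↑ʳ;
         splitAt⁻¹-↑ˡ; splitAt⁻¹-↑ʳ; remQuot-combine; any?; all?)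
import Data.Fin.Properties as Fin
open import Relation.Nullary using (¬_; Dec; yes; no)
open import Relation.Nullary.Decidable using (_×-dec_; _→-dec_; ¬?; map′)
open import Level using (0ℓ)
open import Relation.Unary using (Pred; Decidable)
open import Relation.Binary.PropositionalEquality
  using (_≡_; _≢_; _≗_; refl; sym; trans; cong)

module _ {p} {P : Pred ℕ p} (P? : Decidable P) where

  LeastWitnessBelow : ℕ → Set p
  LeastWitnessBelow n = ∃ λ k → P k × (∀ m → P m → k ≤ m) × k ≤ n

  least : ∀ n → P n → LeastWitnessBelow n
  least = <-rec (λ n → P n → LeastWitnessBelow n) descend
    where
    descend : ∀ n → (∀ {m} → m < n → P m → LeastWitnessBelow m) → P n → LeastWitnessBelow n
    descend n rec pn with anyUpTo? P? n
    ... | no none = n , pn , (λ m pm → ≮⇒≥ (λ m<n → none (m , m<n , pm))) , ≤-refl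
    ... | yes (m , m<n , pm) with rec m<n pm
    ...   | k , pk , minimal , k≤m = k , pk , minimal , ≤-trans k≤m (<⇒≤ m<n)

-- P must respect ≗ since f and head f ∷ tail f are only pointwise equal.
anyFunction? : ∀ n {m} {P : Pred (Vector (Fin m) n) 0ℓ} →
  (∀ {f g} → f ≗ g → P f → P g) → Decidable P → Dec (∃ P)
anyFunction? zero resp P? with P? (λ ())
... | yes pf = yes (_ , pf)
... | no ¬pf = no λ (f , pf) → ¬pf (resp (λ ()) pf)
anyFunction? (suc n) {m} resp P? =
  map′ (λ (a , f , pf) → a ∷ f , pf)
       (λ (f , pf) → head f , tail f , resp head∷tail pf)
       (any? λ a → anyFunction? n (λ f≗g → resp (∷-≗ a f≗g)) (λ f → P? (a ∷ f)))
  where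
  head∷tail : ∀ {f : Vector (Fin m) (suc n)} → f ≗ head f ∷ tail f
  head∷tail zero    = refl
  head∷tail (suc x) = refl

  ∷-≗ : ∀ a {f g : Vector (Fin m) n} → f ≗ g → a ∷ f ≗ a ∷ g
  ∷-≗ a f≗g zero    = refl
  ∷-≗ a f≗g (suc x) = f≗g x

IsTDColoring : (G : Graph) (k : ℕ) → Pred (Fin (order G) → Fin k) 0ℓ
IsTDColoring G k c =
    (∀ j → ∃ λ v → c v ≡ j)
  × (∀ u v → Adj G u v → c u ≢ c v)
  × (∀ v → ∃ λ j → ∀ u → c u ≡ j → Adj G v u)

isTDColoring? : ∀ G k → Decidable (IsTDColoring G k)
isTDColoring? G k c =
      all? (λ j → any? λ v → c v Fin.≟ j)
  ×-dec all? (λ u → all? λ v → (adj G u v Bool.≟ true) →-dec ¬? (c u Fin.≟ c v))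
  ×-dec all? (λ v → any? λ j → all? λ u → (c u Fin.≟ j) →-dec (adj G v u Bool.≟ true))

IsTDColoring-resp-≗ : ∀ {G k c d} → c ≗ d → IsTDColoring G k c → IsTDColoring G k d
IsTDColoring-resp-≗ c≗d (surjective , proper , dominating) =
    (λ j → let v , cv≡j = surjective j in v , trans (sym (c≗d v)) cv≡j)
  , (λ u v uv du≡dv → proper u v uv (trans (c≗d u) (trans du≡dv (sym (c≗d v)))))
  , (λ v → let j , dom = dominating v in j , λ u du≡j → dom u (trans (c≗d u) du≡j))

TDColorable : Graph → Pred ℕ 0ℓ
TDColorable G k = ∃ (IsTDColoring G k)

tdColorable? : ∀ G → Decidable (TDColorable G)
tdColorable? G k = anyFunction? (order G) IsTDColoring-resp-≗ (isTDColoring? G k)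

TDColoring⇒TDColorable : ∀ {G k} → TDColoring G k → TDColorable G k
TDColoring⇒TDColorable C = color , surjective , proper , dominating
  where open TDColoring C

TDColorable⇒TDColoring : ∀ {G k} → TDColorable G k → TDColoring G k
TDColorable⇒TDColoring (c , surjective , proper , dominating) = record
  { color = c ; surjective = surjective ; proper = proper ; dominating = dominating }

tdChromaticNumber-≤ : ∀ {G m} → TDColoring G m → ∃ λ k → IsTDChromaticNumber G k × k ≤ m
tdChromaticNumber-≤ {G} {m} C
  with least (tdColorable? G) m (TDColoring⇒TDColorable C)
... | k , colorable , minimal , k≤m =
  k , (TDColorable⇒TDColoring colorable , λ m D → minimal m (TDColoring⇒TDColorable D)) , k≤m

emptyTDColoring : ∀ G → ¬ Fin (order G) → TDColoring G 0
emptyTDColoring G empty = record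
  { color      = λ v → ⊥-elim (empty v)
  ; surjective = λ ()
  ; proper     = λ u → ⊥-elim (empty u)
  ; dominating = λ v → ⊥-elim (empty v)
  }

↑ˡ≢↑ʳ : ∀ {m n} (i : Fin m) (j : Fin n) → i ↑ˡ n ≢ m ↑ʳ j
↑ˡ≢↑ʳ zero    j ()
↑ˡ≢↑ʳ (suc i) j eq = ↑ˡ≢↑ʳ i j (suc-injective eq)

module _ (G₁ G₂ : Graph) where

  CoronaVertex : Set
  CoronaVertex = Fin (order G₁) ⊎ (Fin (order G₁) × Fin (order G₂))

  base : CoronaVertex → Fin (order G₁)
  base (inj₁ i)       = i
  base (inj₂ (i , x)) = i

  coronaAdj-base : ∀ a j → Adj G₁ (base a) j → coronaAdj G₁ G₂ a (inj₁ j) ≡ true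
  coronaAdj-base (inj₁ i)       j ij = ij
  coronaAdj-base (inj₂ (i , x)) j ij = ij

  decode-↑ˡ : ∀ i → decode G₁ G₂ (i ↑ˡ (order G₁ * order G₂)) ≡ inj₁ i
  decode-↑ˡ i rewrite splitAt-↑ˡ (order G₁) i (order G₁ * order G₂) = refl

  decode-↑ʳ : ∀ i x → decode G₁ G₂ (order G₁ ↑ʳ combine i x) ≡ inj₂ (i , x)
  decode-↑ʳ i x rewrite splitAt-↑ʳ (order G₁) (order G₁ * order G₂) (combine i x)
                      | remQuot-combine {order G₁} {order G₂} i x = refl

module CoronaColoring {G₁ G₂ : Graph} {k₁ k₂ : ℕ}
                      (C₁ : TDColoring G₁ k₁) (C₂ : TDColoring G₂ k₂) where
  open TDColoring

  colour : CoronaVertex G₁ G₂ → Fin (k₁ + k₂)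
  colour (inj₁ i)       = color C₁ i ↑ˡ k₂
  colour (inj₂ (i , x)) = k₁ ↑ʳ color C₂ x

  colour-proper : ∀ a b → coronaAdj G₁ G₂ a b ≡ true → colour a ≢ colour b
  colour-proper (inj₁ i)       (inj₁ j)       ij eq = proper C₁ i j ij (↑ˡ-injective k₂ _ _ eq)
  colour-proper (inj₁ i)       (inj₂ (j , y)) _  eq = ↑ˡ≢↑ʳ _ _ eq
  colour-proper (inj₂ (i , x)) (inj₁ j)       _  eq = ↑ˡ≢↑ʳ _ _ (sym eq)
  colour-proper (inj₂ (i , x)) (inj₂ (j , y)) ab eq with i Fin.≟ j
  ... | yes _ = proper C₂ x y ab (↑ʳ-injective k₁ _ _ eq)
  ... | no _  with ab
  ...   | ()

  colour-dominating : ∀ a → ∃ λ j → ∀ b → colour b ≡ j → coronaAdj G₁ G₂ a b ≡ true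
  colour-dominating a = dominated ↑ˡ k₂ , adjacent
    where
    dominated : Fin k₁
    dominated = proj₁ (dominating C₁ (base G₁ G₂ a))

    adjacent : ∀ b → colour b ≡ dominated ↑ˡ k₂ → coronaAdj G₁ G₂ a b ≡ true
    adjacent (inj₁ j)       eq = coronaAdj-base G₁ G₂ a j
      (proj₂ (dominating C₁ (base G₁ G₂ a)) j (↑ˡ-injective k₂ _ _ eq))
    adjacent (inj₂ (j , y)) eq = ⊥-elim (↑ˡ≢↑ʳ _ _ (sym eq))

  -- The colours of G₂ are all realised in a single copy, which needs G₁ ≠ ∅.
  colour-surjective : Fin (order G₁) → ∀ j → ∃ λ v → colour (decode G₁ G₂ v) ≡ j
  colour-surjective i j with splitAt k₁ j in eq
  ... | inj₁ a = let v , cv≡a = surjective C₁ a in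
    v ↑ˡ _ , trans (cong colour (decode-↑ˡ G₁ G₂ v))
                   (trans (cong (_↑ˡ k₂) cv≡a) (splitAt⁻¹-↑ˡ eq))
  ... | inj₂ b = let x , cx≡b = surjective C₂ b in
    order G₁ ↑ʳ combine i x , trans (cong colour (decode-↑ʳ G₁ G₂ i x))
                                    (trans (cong (k₁ ↑ʳ_) cx≡b) (splitAt⁻¹-↑ʳ eq))

  coronaTDColoring : Fin (order G₁) → TDColoring (G₁ ⋆ G₂) (k₁ + k₂)
  coronaTDColoring i = record
    { color      = λ v → colour (decode G₁ G₂ v)
    ; surjective = colour-surjective i
    ; proper     = λ u v → colour-proper (decode G₁ G₂ u) (decode G₁ G₂ v)
    ; dominating = λ v → let j , dom = colour-dominating (decode G₁ G₂ v) in
                         j , λ u → dom (decode G₁ G₂ u)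
    }

inhabited? : ∀ n → Dec (Fin n)
inhabited? zero    = no λ ()
inhabited? (suc n) = yes zero

theorem2p3 : (G₁ G₂ : Graph) → IsSimple G₁ → IsSimple G₂ →
    Connected G₁ → Connected G₂ → NoIsolated G₁ → NoIsolated G₂ →
    (k₁ k₂ : ℕ) → IsTDChromaticNumber G₁ k₁ → IsTDChromaticNumber G₂ k₂ →
    ∃ λ k → IsTDChromaticNumber (G₁ ⋆ G₂) k × k ≤ k₁ + k₂
theorem2p3 G₁ G₂ _ _ _ _ _ _ k₁ k₂ (C₁ , _) (C₂ , _) with inhabited? (order G₁)
... | yes i = tdChromaticNumber-≤ (CoronaColoring.coronaTDColoring C₁ C₂ i)
... | no empty =
  let k , χ , k≤0 = tdChromaticNumber-≤ (emptyTDColoring (G₁ ⋆ G₂) (empty ∘ coronaBase))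
  in k , χ , ≤-trans k≤0 z≤n
  where
  coronaBase : Fin (order (G₁ ⋆ G₂)) → Fin (order G₁)
  coronaBase v = base G₁ G₂ (decode G₁ G₂ v)
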